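{- $E_{FTP}$ is sound and ground-complete for bisimilarity on $T(\Sigma_{FTP})$: for all $t,t'\in T(\Sigma_{FTP})$, $E_{FTP}\vdash t=t'$ if and only if $t\sim t'$.
   Context: Fix a finite nonempty set of actions $\mathcal{A}$, a finite set of predicates $\mathcal{P}$, a subset $\mathcal{P}^I\subseteq\mathcal{P}$ and for each $P\in\mathcal{P}^I$ a set $\mathcal{A}_P\subseteq\mathcal{A}$. $\Sigma_{FTP}$ consists of the constant $\delta$, constants $\kappa_P$ ($P\in\mathcal{P}$), unary prefixes $a.\_$ ($a\in\mathcal{A}$) and binary $+$, with semantics given by the least relations closed under: $a.x\xrightarrow{a}x$; $x\xrightarrow{a}x'\Rightarrow x+y\xrightarrow{a}x'$; $y\xrightarrow{a}y'\Rightarrow x+y\xrightarrow{a}y'$; $P\kappa_P$; $Px\Rightarrow P(x+y)$; $Py\Rightarrow P(x+y)$; $Px\Rightarrow P(a.x)$ for $P\in\mathcal{P}^I$, $a\in\mathcal{A}_P$. $E_{FTP}$: $x+y=y+x$; $(x+y)+z=x+(y+z)$; $x+x=x$; $x+\delta=x$; $a.(x+\kappa_P)=a.(x+\kappa_P)+\kappa_P$ for $P\in\mathcal{P}^I$, $a\in\mathcal{A}_P$. $\vdash$ is derivability in equational logic. A symmetric relation $R$ on closed terms is a bisimulation if $(s,t)\in R$ and $s\xrightarrow{a}s'$ imply $t\xrightarrow{a}t'$ with $(s',t')\in R$, and $(s,t)\in R$ and $Ps$ imply $Pt$; $\sim$ is the union of all bisimulations. -}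

module Defs where

open import Data.Nat using (ℕ; suc)
open import Data.Fin using (Fin)
open import Data.Fin.Subset using (Subset; _∈_)
open import Data.Empty using (⊥)
open import Data.Product using (Σ; _×_)
open import Level using (0ℓ)
open import Relation.Binary using (Rel; Symmetric)

-- Parameters: actions 𝒜 = Fin (suc m) (finite, nonempty),
-- predicates 𝒫 = Fin n (finite), 𝒫ᴵ = PI ⊆ 𝒫, and 𝒜_P = AP P ⊆ 𝒜
-- (AP P is only ever consulted for P ∈ PI).
module FTP (m n : ℕ) (PI : Subset n) (AP : Fin n → Subset (suc m)) where

  Act : Set
  Act = Fin (suc m)

  Pred : Set
  Pred = Fin n

  data Term (V : Set) : Set where
    var  : V → Term V
    δ    : Term V
    κ    : Pred → Term V
    _∙_  : Act → Term V → Term V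
    _⊕_  : Term V → Term V → Term V

  infixr 7 _∙_
  infixl 6 _⊕_

  Closed : Set
  Closed = Term ⊥

  Open : Set
  Open = Term ℕ

  _[_] : {V W : Set} → Term V → (V → Term W) → Term W
  var x   [ σ ] = σ x
  δ       [ σ ] = δ
  κ P     [ σ ] = κ P
  (a ∙ t) [ σ ] = a ∙ (t [ σ ])
  (t ⊕ u) [ σ ] = (t [ σ ]) ⊕ (u [ σ ])

  embed : Closed → Open
  embed t = t [ (λ ()) ]

  x y z : Open
  x = var 0
  y = var 1
  z = var 2

  data Axiom : Open → Open → Set where
    comm  : Axiom (x ⊕ y) (y ⊕ x)
    assoc : Axiom ((x ⊕ y) ⊕ z) (x ⊕ (y ⊕ z))
    idem  : Axiom (x ⊕ x) x
    unit  : Axiom (x ⊕ δ) x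
    pers  : ∀ {P a} → P ∈ PI → a ∈ AP P →
            Axiom (a ∙ (x ⊕ κ P)) ((a ∙ (x ⊕ κ P)) ⊕ κ P)

  infix 4 E⊢_≈_
  data E⊢_≈_ : Open → Open → Set where
    ax    : ∀ {l r} → Axiom l r → E⊢ l ≈ r
    refl  : ∀ {t} → E⊢ t ≈ t
    sym   : ∀ {t u} → E⊢ t ≈ u → E⊢ u ≈ t
    trans : ∀ {t u v} → E⊢ t ≈ u → E⊢ u ≈ v → E⊢ t ≈ v
    subst : ∀ {t u} (σ : ℕ → Open) → E⊢ t ≈ u → E⊢ t [ σ ] ≈ u [ σ ]
    cong∙ : ∀ {a t u} → E⊢ t ≈ u → E⊢ a ∙ t ≈ a ∙ u
    cong⊕ : ∀ {t t' u u'} → E⊢ t ≈ t' → E⊢ u ≈ u' → E⊢ t ⊕ u ≈ t' ⊕ u'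

  data _─[_]→_ : Closed → Act → Closed → Set where
    pre  : ∀ {a t} → (a ∙ t) ─[ a ]→ t
    sumˡ : ∀ {a t t' u} → t ─[ a ]→ t' → (t ⊕ u) ─[ a ]→ t'
    sumʳ : ∀ {a t u u'} → u ─[ a ]→ u' → (t ⊕ u) ─[ a ]→ u'

  data Holds : Pred → Closed → Set where
    const : ∀ {P} → Holds P (κ P)
    sumˡ  : ∀ {P t u} → Holds P t → Holds P (t ⊕ u)
    sumʳ  : ∀ {P t u} → Holds P u → Holds P (t ⊕ u)
    pre   : ∀ {P a t} → P ∈ PI → a ∈ AP P → Holds P t → Holds P (a ∙ t)

  record IsBisimulation (R : Rel Closed 0ℓ) : Set where
    field
      symmetric : Symmetric R
      step      : ∀ {s t a s'} → R s t → s ─[ a ]→ s' →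
                  Σ Closed (λ t' → (t ─[ a ]→ t') × R s' t')
      pred      : ∀ {s t P} → R s t → Holds P s → Holds P t

  _∼_ : Closed → Closed → Set₁
  s ∼ t = Σ (Rel Closed 0ℓ) (λ R → IsBisimulation R × R s t)

-- Every closed instance l[ρ] = r[ρ] of an axiom relates two
-- terms with literally the same transitions and predicates.  Hence the
-- congruence _≐_ on closed terms generated by these instances is itself a
-- bisimulation: its transfer property is preserved by each closure rule
-- (symmetry, transitivity, prefixing, choice).  A derivation E ⊢ u = v
-- yields u[ρ] ≐ v[ρ] for every closing substitution ρ, so provably equal
-- closed terms are bisimilar.
--
-- Write "u absorbs w" for E ⊢ u = u + w.  A closed term
-- absorbs a.s for each of its transitions t ─a→ s and κ_P for each of its
-- predicates P (the latter is where the persistence axiom is used), and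
-- u absorbs t' as soon as it absorbs all of these summands of t'.  If
-- t ∼ t', then by well-founded induction along transitions every summand
-- of t is provably equal to a summand of t', so t' absorbs t and, by
-- symmetry, t absorbs t'; mutual absorption gives E ⊢ t = t'.
module Submission where

open import Defs
open import Data.Nat using (ℕ; suc)
open import Data.Fin using (Fin)
open import Data.Fin.Subset using (Subset; _∈_)
open import Data.Product using (Σ; _×_; _,_; proj₁; swap)
open import Level using (0ℓ)
open import Relation.Binary using (Rel; Setoid; Reflexive; Transitive)
open import Induction.WellFounded using (Acc; acc; acc-inverse; WellFounded)
open import Relation.Binary.PropositionalEquality as Eq using (_≡_)
import Relation.Binary.Reasoning.Setoid as SetoidReasoning

module Proof (m n : ℕ) (PI : Subset n) (AP : Fin n → Subset (suc m)) where
  open FTP m n PI AP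

  [][]-comp : ∀ {W} (u : Open) (σ : ℕ → Open) (ρ : ℕ → Term W) →
              (u [ σ ]) [ ρ ] ≡ u [ (λ i → σ i [ ρ ]) ]
  [][]-comp (var i) σ ρ = Eq.refl
  [][]-comp δ       σ ρ = Eq.refl
  [][]-comp (κ P)   σ ρ = Eq.refl
  [][]-comp (a ∙ u) σ ρ = Eq.cong (a ∙_) ([][]-comp u σ ρ)
  [][]-comp (u ⊕ v) σ ρ = Eq.cong₂ _⊕_ ([][]-comp u σ ρ) ([][]-comp v σ ρ)

  embed-[] : (t : Closed) (ρ : ℕ → Closed) → embed t [ ρ ] ≡ t
  embed-[] (var ())
  embed-[] δ       ρ = Eq.refl
  embed-[] (κ P)   ρ = Eq.refl
  embed-[] (a ∙ t) ρ = Eq.cong (a ∙_) (embed-[] t ρ)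
  embed-[] (t ⊕ u) ρ = Eq.cong₂ _⊕_ (embed-[] t ρ) (embed-[] u ρ)

  infix 4 _⊑_
  record _⊑_ (s t : Closed) : Set where
    field
      moves : ∀ {a s'} → s ─[ a ]→ s' → t ─[ a ]→ s'
      preds : ∀ {P} → Holds P s → Holds P t
  open _⊑_

  ⊑-refl : ∀ {t} → t ⊑ t
  ⊑-refl = record { moves = λ tr → tr ; preds = λ h → h }

  ⊑-trans : ∀ {s t u} → s ⊑ t → t ⊑ u → s ⊑ u
  ⊑-trans s⊑t t⊑u = record { moves = λ tr → moves t⊑u (moves s⊑t tr)
                           ; preds = λ h → preds t⊑u (preds s⊑t h) }

  δ-⊑ : ∀ {t} → δ ⊑ t
  δ-⊑ = record { moves = λ () ; preds = λ () }

  ⊑-⊕ˡ : ∀ {p q} → p ⊑ p ⊕ q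
  ⊑-⊕ˡ = record { moves = sumˡ ; preds = sumˡ }

  ⊑-⊕ʳ : ∀ {p q} → q ⊑ p ⊕ q
  ⊑-⊕ʳ = record { moves = sumʳ ; preds = sumʳ }

  ⊕-⊑ : ∀ {p q t} → p ⊑ t → q ⊑ t → p ⊕ q ⊑ t
  ⊕-⊑ p⊑t q⊑t = record { moves = λ { (sumˡ tr) → moves p⊑t tr ; (sumʳ tr) → moves q⊑t tr }
                       ; preds = λ { (sumˡ h) → preds p⊑t h ; (sumʳ h) → preds q⊑t h } }

  κ-⊑ : ∀ {P t} → Holds P t → κ P ⊑ t
  κ-⊑ h = record { moves = λ () ; preds = λ { const → h } }

  axiom-⊑ : ∀ {l r} → Axiom l r → (ρ : ℕ → Closed) → l [ ρ ] ⊑ r [ ρ ] × r [ ρ ] ⊑ l [ ρ ]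
  axiom-⊑ comm  ρ = ⊕-⊑ ⊑-⊕ʳ ⊑-⊕ˡ , ⊕-⊑ ⊑-⊕ʳ ⊑-⊕ˡ
  axiom-⊑ assoc ρ = ⊕-⊑ (⊕-⊑ ⊑-⊕ˡ (⊑-trans ⊑-⊕ˡ ⊑-⊕ʳ)) (⊑-trans ⊑-⊕ʳ ⊑-⊕ʳ)
                  , ⊕-⊑ (⊑-trans ⊑-⊕ˡ ⊑-⊕ˡ) (⊕-⊑ (⊑-trans ⊑-⊕ʳ ⊑-⊕ˡ) ⊑-⊕ʳ)
  axiom-⊑ idem  ρ = ⊕-⊑ ⊑-refl ⊑-refl , ⊑-⊕ˡ
  axiom-⊑ unit  ρ = ⊕-⊑ ⊑-refl δ-⊑ , ⊑-⊕ˡ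
  axiom-⊑ (pers P∈PI a∈AP) ρ = ⊑-⊕ˡ , ⊕-⊑ ⊑-refl (κ-⊑ (pre P∈PI a∈AP (sumʳ const)))

  record Transfer (R : Rel Closed 0ℓ) (s t : Closed) : Set where
    field
      match : ∀ {a s'} → s ─[ a ]→ s' → Σ Closed (λ t' → (t ─[ a ]→ t') × R s' t')
      keep  : ∀ {P} → Holds P s → Holds P t
  open Transfer

  module _ {R : Rel Closed 0ℓ} where

    ⊑-transfer : Reflexive R → ∀ {s t} → s ⊑ t → Transfer R s t
    ⊑-transfer R-refl s⊑t = record { match = λ {_} {s'} tr → s' , moves s⊑t tr , R-refl
                                   ; keep  = preds s⊑t }

    transfer-trans : Transitive R → ∀ {s t u} → Transfer R s t → Transfer R t u → Transfer R s u
    transfer-trans R-trans s→t t→u = record { match = matchᵤ ; keep = λ h → keep t→u (keep s→t h) }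
      where
      matchᵤ : ∀ {a s'} → _ ─[ a ]→ s' → Σ Closed (λ u' → (_ ─[ a ]→ u') × R s' u')
      matchᵤ tr with match s→t tr
      ... | t' , trₜ , s'Rt' with match t→u trₜ
      ...   | u' , trᵤ , t'Ru' = u' , trᵤ , R-trans s'Rt' t'Ru'

    transfer-∙ : ∀ {a s t} → R s t → Transfer R s t → Transfer R (a ∙ s) (a ∙ t)
    transfer-∙ {t = t} sRt s→t = record { match = λ { pre → t , pre , sRt }
                                        ; keep  = λ { (pre P∈PI a∈AP h) → pre P∈PI a∈AP (keep s→t h) } }

    transfer-⊕ : ∀ {p p' q q'} → Transfer R p p' → Transfer R q q' → Transfer R (p ⊕ q) (p' ⊕ q')
    transfer-⊕ p→p' q→q' = record { match = matchₛ ; keep = keepₛ }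
      where
      matchₛ : ∀ {a s'} → _ ─[ a ]→ s' → Σ Closed (λ t' → (_ ─[ a ]→ t') × R s' t')
      matchₛ (sumˡ tr) with match p→p' tr
      ... | t' , tr' , r = t' , sumˡ tr' , r
      matchₛ (sumʳ tr) with match q→q' tr
      ... | t' , tr' , r = t' , sumʳ tr' , r
      keepₛ : ∀ {P} → Holds P _ → Holds P _
      keepₛ (sumˡ h) = sumˡ (keep p→p' h)
      keepₛ (sumʳ h) = sumʳ (keep q→q' h)

  infix 4 _≐_
  data _≐_ : Closed → Closed → Set where
    ≐-axiom : ∀ {l r} → Axiom l r → (ρ : ℕ → Closed) → l [ ρ ] ≐ r [ ρ ]
    ≐-refl  : ∀ {t} → t ≐ t
    ≐-sym   : ∀ {s t} → s ≐ t → t ≐ s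
    ≐-trans : ∀ {s t u} → s ≐ t → t ≐ u → s ≐ u
    ≐-∙     : ∀ {a s t} → s ≐ t → a ∙ s ≐ a ∙ t
    ≐-⊕     : ∀ {p p' q q'} → p ≐ p' → q ≐ q' → p ⊕ q ≐ p' ⊕ q'

  ≐-transfer : ∀ {s t} → s ≐ t → Transfer _≐_ s t × Transfer _≐_ t s
  ≐-transfer (≐-axiom A ρ) = let l⊑r , r⊑l = axiom-⊑ A ρ in
                             ⊑-transfer ≐-refl l⊑r , ⊑-transfer ≐-refl r⊑l
  ≐-transfer ≐-refl        = ⊑-transfer ≐-refl ⊑-refl , ⊑-transfer ≐-refl ⊑-refl
  ≐-transfer (≐-sym d)     = swap (≐-transfer d)
  ≐-transfer (≐-trans d e) = let d→ , d← = ≐-transfer d ; e→ , e← = ≐-transfer e in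
                             transfer-trans ≐-trans d→ e→ , transfer-trans ≐-trans e← d←
  ≐-transfer (≐-∙ d)       = let d→ , d← = ≐-transfer d in
                             transfer-∙ d d→ , transfer-∙ (≐-sym d) d←
  ≐-transfer (≐-⊕ d e)     = let d→ , d← = ≐-transfer d ; e→ , e← = ≐-transfer e in
                             transfer-⊕ d→ e→ , transfer-⊕ d← e←

  ≐-bisimulation : IsBisimulation _≐_
  ≐-bisimulation = record
    { symmetric = ≐-sym
    ; step      = λ d → match (proj₁ (≐-transfer d))
    ; pred      = λ d → keep (proj₁ (≐-transfer d)) }

  derivable-≐ : ∀ {u v} → E⊢ u ≈ v → (ρ : ℕ → Closed) → u [ ρ ] ≐ v [ ρ ]
  derivable-≐ (ax A)      ρ = ≐-axiom A ρ
  derivable-≐ refl        ρ = ≐-refl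
  derivable-≐ (sym d)     ρ = ≐-sym (derivable-≐ d ρ)
  derivable-≐ (trans d e) ρ = ≐-trans (derivable-≐ d ρ) (derivable-≐ e ρ)
  derivable-≐ (subst {u} {v} σ d) ρ =
    Eq.subst₂ _≐_ (Eq.sym ([][]-comp u σ ρ)) (Eq.sym ([][]-comp v σ ρ))
              (derivable-≐ d (λ i → σ i [ ρ ]))
  derivable-≐ (cong∙ d)   ρ = ≐-∙ (derivable-≐ d ρ)
  derivable-≐ (cong⊕ d e) ρ = ≐-⊕ (derivable-≐ d ρ) (derivable-≐ e ρ)

  soundness : ∀ {t t'} → E⊢ embed t ≈ embed t' → t ∼ t'
  soundness {t} {t'} d = _≐_ , ≐-bisimulation , Eq.subst₂ _≐_ (embed-[] t ρ) (embed-[] t' ρ) (derivable-≐ d ρ)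
    where
    ρ : ℕ → Closed
    ρ _ = δ

  E-setoid : Setoid 0ℓ 0ℓ
  E-setoid = record
    { Carrier = Open ; _≈_ = E⊢_≈_
    ; isEquivalence = record { refl = refl ; sym = sym ; trans = trans } }
  open SetoidReasoning E-setoid

  ⟨_,_,_⟩ : Open → Open → Open → ℕ → Open
  ⟨ p , q , w ⟩ 0 = p
  ⟨ p , q , w ⟩ 1 = q
  ⟨ p , q , w ⟩ _ = w

  ⊕-comm : ∀ p q → E⊢ p ⊕ q ≈ q ⊕ p
  ⊕-comm p q = subst ⟨ p , q , δ ⟩ (ax comm)

  ⊕-assoc : ∀ p q w → E⊢ (p ⊕ q) ⊕ w ≈ p ⊕ (q ⊕ w)
  ⊕-assoc p q w = subst ⟨ p , q , w ⟩ (ax assoc)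

  ⊕-idem : ∀ p → E⊢ p ⊕ p ≈ p
  ⊕-idem p = subst ⟨ p , δ , δ ⟩ (ax idem)

  ⊕-δ : ∀ p → E⊢ p ⊕ δ ≈ p
  ⊕-δ p = subst ⟨ p , δ , δ ⟩ (ax unit)

  ∙-persistent : ∀ {P a} → P ∈ PI → a ∈ AP P → ∀ p →
                 E⊢ a ∙ (p ⊕ κ P) ≈ (a ∙ (p ⊕ κ P)) ⊕ κ P
  ∙-persistent P∈PI a∈AP p = subst ⟨ p , δ , δ ⟩ (ax (pers P∈PI a∈AP))

  Absorbs : Open → Open → Set
  Absorbs u w = E⊢ u ≈ u ⊕ w

  absorbs-self : ∀ u → Absorbs u u
  absorbs-self u = sym (⊕-idem u)

  absorbs-δ : ∀ u → Absorbs u δ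
  absorbs-δ u = sym (⊕-δ u)

  absorbs-⊕ʳ : ∀ {p q w} → Absorbs q w → Absorbs (p ⊕ q) w
  absorbs-⊕ʳ {p} {q} {w} q⊒w = begin
    p ⊕ q         ≈⟨ cong⊕ refl q⊒w ⟩
    p ⊕ (q ⊕ w)   ≈⟨ sym (⊕-assoc p q w) ⟩
    (p ⊕ q) ⊕ w   ∎

  absorbs-⊕ˡ : ∀ {p q w} → Absorbs p w → Absorbs (p ⊕ q) w
  absorbs-⊕ˡ {p} {q} {w} p⊒w = begin
    p ⊕ q         ≈⟨ ⊕-comm p q ⟩
    q ⊕ p         ≈⟨ absorbs-⊕ʳ p⊒w ⟩
    (q ⊕ p) ⊕ w   ≈⟨ cong⊕ (⊕-comm q p) refl ⟩
    (p ⊕ q) ⊕ w   ∎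

  absorbs-sum : ∀ {u p q} → Absorbs u p → Absorbs u q → Absorbs u (p ⊕ q)
  absorbs-sum {u} {p} {q} u⊒p u⊒q = begin
    u             ≈⟨ u⊒q ⟩
    u ⊕ q         ≈⟨ cong⊕ u⊒p refl ⟩
    (u ⊕ p) ⊕ q   ≈⟨ ⊕-assoc u p q ⟩
    u ⊕ (p ⊕ q)   ∎

  mutual-absorption : ∀ {u v} → Absorbs u v → Absorbs v u → E⊢ u ≈ v
  mutual-absorption {u} {v} u⊒v v⊒u = begin
    u       ≈⟨ u⊒v ⟩
    u ⊕ v   ≈⟨ ⊕-comm u v ⟩
    v ⊕ u   ≈⟨ sym v⊒u ⟩
    v       ∎

  derivative-absorbed : ∀ {t a s} → t ─[ a ]→ s → Absorbs (embed t) (a ∙ embed s)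
  derivative-absorbed {a ∙ s} pre = absorbs-self (a ∙ embed s)
  derivative-absorbed (sumˡ tr)   = absorbs-⊕ˡ (derivative-absorbed tr)
  derivative-absorbed (sumʳ tr)   = absorbs-⊕ʳ (derivative-absorbed tr)

  -- A closed term absorbs κ P for each predicate P it satisfies; through a
  -- prefix this is exactly the persistence axiom.
  predicate-absorbed : ∀ {P t} → Holds P t → Absorbs (embed t) (κ P)
  predicate-absorbed {P} const = absorbs-self (κ P)
  predicate-absorbed (sumˡ h)  = absorbs-⊕ˡ (predicate-absorbed h)
  predicate-absorbed (sumʳ h)  = absorbs-⊕ʳ (predicate-absorbed h)
  predicate-absorbed {P} (pre {a = a} {t} P∈PI a∈AP h) = begin
    a ∙ embed t                     ≈⟨ cong∙ t⊒P ⟩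
    a ∙ (embed t ⊕ κ P)             ≈⟨ ∙-persistent P∈PI a∈AP (embed t) ⟩
    (a ∙ (embed t ⊕ κ P)) ⊕ κ P     ≈⟨ cong⊕ (cong∙ (sym t⊒P)) refl ⟩
    (a ∙ embed t) ⊕ κ P             ∎
    where
    t⊒P : Absorbs (embed t) (κ P)
    t⊒P = predicate-absorbed h

  absorbs-behaviour : ∀ u (t : Closed) →
                      (∀ {a s} → t ─[ a ]→ s → Absorbs u (a ∙ embed s)) →
                      (∀ {P} → Holds P t → Absorbs u (κ P)) →
                      Absorbs u (embed t)
  absorbs-behaviour u (var ())
  absorbs-behaviour u δ       moves⊒ preds⊒ = absorbs-δ u
  absorbs-behaviour u (κ P)   moves⊒ preds⊒ = preds⊒ const
  absorbs-behaviour u (a ∙ s) moves⊒ preds⊒ = moves⊒ pre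
  absorbs-behaviour u (p ⊕ q) moves⊒ preds⊒ = absorbs-sum
    (absorbs-behaviour u p (λ tr → moves⊒ (sumˡ tr)) (λ h → preds⊒ (sumˡ h)))
    (absorbs-behaviour u q (λ tr → moves⊒ (sumʳ tr)) (λ h → preds⊒ (sumʳ h)))

  -- s ⊲ t: s is a derivative of t.  Transitions strictly shrink terms, so ⊲
  -- is well founded.
  _⊲_ : Rel Closed 0ℓ
  s ⊲ t = Σ Act (λ a → t ─[ a ]→ s)

  ⊲-wellFounded : WellFounded _⊲_
  ⊲-wellFounded (var ())
  ⊲-wellFounded δ       = acc λ ()
  ⊲-wellFounded (κ P)   = acc λ ()
  ⊲-wellFounded (a ∙ t) = acc λ { (_ , pre) → ⊲-wellFounded t }
  ⊲-wellFounded (p ⊕ q) = acc λ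
    { (a , sumˡ tr) → acc-inverse (⊲-wellFounded p) (a , tr)
    ; (a , sumʳ tr) → acc-inverse (⊲-wellFounded q) (a , tr) }

  ∼-sym : ∀ {t t'} → t ∼ t' → t' ∼ t
  ∼-sym (R , B , r) = R , B , IsBisimulation.symmetric B r

  ∼-step : ∀ {t t' a s} → t ∼ t' → t ─[ a ]→ s → Σ Closed (λ s' → (t' ─[ a ]→ s') × s ∼ s')
  ∼-step (R , B , r) tr with IsBisimulation.step B r tr
  ... | s' , tr' , r' = s' , tr' , (R , B , r')

  ∼-pred : ∀ {t t' P} → t ∼ t' → Holds P t → Holds P t'
  ∼-pred (R , B , r) = IsBisimulation.pred B r

  mutual
    bisimilar-absorbs : ∀ {t t'} → Acc _⊲_ t → Acc _⊲_ t' → t ∼ t' → Absorbs (embed t') (embed t)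
    bisimilar-absorbs {t} {t'} (acc rs) (acc rs') t∼t' =
      absorbs-behaviour (embed t') t moves⊒ (λ h → predicate-absorbed (∼-pred t∼t' h))
      where
      moves⊒ : ∀ {a s} → t ─[ a ]→ s → Absorbs (embed t') (a ∙ embed s)
      moves⊒ {a} {s} tr with ∼-step t∼t' tr
      ... | s' , tr' , s∼s' = begin
        embed t'                  ≈⟨ derivative-absorbed tr' ⟩
        embed t' ⊕ a ∙ embed s'   ≈⟨ cong⊕ refl (cong∙ (sym s≈s')) ⟩
        embed t' ⊕ a ∙ embed s    ∎
        where
        s≈s' : E⊢ embed s ≈ embed s'
        s≈s' = bisimilar-equal (rs (a , tr)) (rs' (a , tr')) s∼s'

    bisimilar-equal : ∀ {t t'} → Acc _⊲_ t → Acc _⊲_ t' → t ∼ t' → E⊢ embed t ≈ embed t'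
    bisimilar-equal acc-t acc-t' t∼t' =
      mutual-absorption (bisimilar-absorbs acc-t' acc-t (∼-sym t∼t'))
                        (bisimilar-absorbs acc-t acc-t' t∼t')

  completeness : ∀ {t t'} → t ∼ t' → E⊢ embed t ≈ embed t'
  completeness {t} {t'} = bisimilar-equal (⊲-wellFounded t) (⊲-wellFounded t')

theorem9 : (m n : ℕ) (PI : Subset n) (AP : Fin n → Subset (suc m)) →
    let open FTP m n PI AP in
    (t t' : Closed) →
      ((E⊢ embed t ≈ embed t') → t ∼ t') × (t ∼ t' → E⊢ embed t ≈ embed t')
theorem9 m n PI AP t t' = soundness , completeness
  where open Proof m n PI AP
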